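{- For every positive integer $n$: (1) the number of partitions of size $n$ that either have dimension $\ge3$ with $\lambda_1<\lambda_2+\lambda_m$ and $2\lambda_2<\lambda_1+\lambda_3$, or have dimension $2$ with $2\lambda_2>\lambda_1$ and $2\lambda_1>3\lambda_2$, equals the number of partitions of size $n$ that either have dimension $\ge3$ with $k_{m-1}<k_m<k_1$, or have dimension $2$ with $k_2<k_1<2k_2$; (2) the number of partitions of size $n$ that either have dimension $\ge3$ with $\lambda_1<\lambda_2+\lambda_m$ and $2\lambda_2>\lambda_1+\lambda_3$, or have dimension $2$ with $2\lambda_2>\lambda_1$ and $2\lambda_1<3\lambda_2$, equals the number of partitions of size $n$ with $k_1<k_m<2k_1$; (3) the number of partitions of size $n$ that either have dimension $\ge3$ with $\lambda_2+\lambda_m<\lambda_1<\lambda_2+2\lambda_m$, or have dimension $2$ with $2\lambda_2<\lambda_1<3\lambda_2$, equals the number of partitions of size $n$ that either have dimension $\ge3$ with $k_m<k_{m-1}$ and $k_m<k_1$, or have dimension $2$ with $2k_2<k_1$; (4) the number of partitions of size $n$ of dimension $\ge2$ with $\lambda_1>\lambda_2+2\lambda_m$ equals the number of partitions of size $n$ with $2k_1<k_m$.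
   Context: A partition is written $(\lambda_1,\dots,\lambda_m)\times[k_1,\dots,k_m]$, where $m\ge1$, the parts $\lambda_i$ are integers with $\lambda_1>\dots>\lambda_m>0$ and the multiplicities $k_i$ are positive integers; $m$ is its dimension and $\sum k_i\lambda_i$ its size. For dimension $m=2$, $\lambda_m=\lambda_2$ and $k_m=k_2$. -}

module Defs where

open import Data.Nat using (ℕ; zero; suc; _+_; _*_; _∸_; _≤_; _<_)
open import Data.List using (List; []; _∷_; length)
open import Data.Product using (Σ; _×_; _,_)
open import Data.Sum using (_⊎_)
open import Data.Unit using (⊤)
open import Relation.Binary.PropositionalEquality using (_≡_)

-- A partition (λ_1,…,λ_m) × [k_1,…,k_m] is represented by the list of
-- pairs (λ_i , k_i), i = 1..m, in order.
Part : Set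
Part = List (ℕ × ℕ)

Decreasing : Part → Set
Decreasing [] = ⊤
Decreasing ((a , k) ∷ []) = (0 < a) × (0 < k)
Decreasing ((a , k) ∷ (b , l) ∷ r) = (b < a) × (0 < k) × Decreasing ((b , l) ∷ r)

dim : Part → ℕ
dim = length

size : Part → ℕ
size [] = 0
size ((a , k) ∷ r) = k * a + size r

IsPartitionOf : ℕ → Part → Set
IsPartitionOf n p = (1 ≤ dim p) × Decreasing p × (size p ≡ n)

-- 1-indexed accessors λ_i and k_i (only used for 1 ≤ i ≤ m)
lam : Part → ℕ → ℕ
lam [] i = 0
lam ((a , k) ∷ r) zero = 0
lam ((a , k) ∷ r) (suc zero) = a
lam ((a , k) ∷ r) (suc (suc i)) = lam r (suc i)

mul : Part → ℕ → ℕ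
mul [] i = 0
mul ((a , k) ∷ r) zero = 0
mul ((a , k) ∷ r) (suc zero) = k
mul ((a , k) ∷ r) (suc (suc i)) = mul r (suc i)

lamLast : Part → ℕ
lamLast p = lam p (dim p)

mulLast : Part → ℕ
mulLast p = mul p (dim p)

mulPenult : Part → ℕ
mulPenult p = mul p (dim p ∸ 1)

PartitionsWith : ℕ → (Part → Set) → Set
PartitionsWith n P = Σ Part (λ p → IsPartitionOf n p × P p)

cond1L : Part → Set
cond1L p =
  ((3 ≤ dim p) × (lam p 1 < lam p 2 + lamLast p) × (2 * lam p 2 < lam p 1 + lam p 3))
  ⊎ ((dim p ≡ 2) × (lam p 1 < 2 * lam p 2) × (3 * lam p 2 < 2 * lam p 1))

cond1R : Part → Set
cond1R p =
  ((3 ≤ dim p) × (mulPenult p < mulLast p) × (mulLast p < mul p 1))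
  ⊎ ((dim p ≡ 2) × (mul p 2 < mul p 1) × (mul p 1 < 2 * mul p 2))

cond2L : Part → Set
cond2L p =
  ((3 ≤ dim p) × (lam p 1 < lam p 2 + lamLast p) × (lam p 1 + lam p 3 < 2 * lam p 2))
  ⊎ ((dim p ≡ 2) × (lam p 1 < 2 * lam p 2) × (2 * lam p 1 < 3 * lam p 2))

cond2R : Part → Set
cond2R p = (mul p 1 < mulLast p) × (mulLast p < 2 * mul p 1)

cond3L : Part → Set
cond3L p =
  ((3 ≤ dim p) × (lam p 2 + lamLast p < lam p 1) × (lam p 1 < lam p 2 + 2 * lamLast p))
  ⊎ ((dim p ≡ 2) × (2 * lam p 2 < lam p 1) × (lam p 1 < 3 * lam p 2))

cond3R : Part → Set
cond3R p =
  ((3 ≤ dim p) × (mulLast p < mulPenult p) × (mulLast p < mul p 1))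
  ⊎ ((dim p ≡ 2) × (2 * mul p 2 < mul p 1))

cond4L : Part → Set
cond4L p = (2 ≤ dim p) × (lam p 2 + 2 * lamLast p < lam p 1)

cond4R : Part → Set
cond4R p = 2 * mul p 1 < mulLast p

-- Each identity is a bijection between two sets of partitions that are both parametrised, without any
-- subtraction, by one set of codes: partitions q of a fixed shape (two parts, or a first part, a middle and
-- one or two last parts). The left-hand partition keeps the multiplicities k of q and replaces its parts λ
-- by Aλ (then lists them in decreasing order), for a matrix A with non-negative entries; the right-hand
-- partition keeps λ and replaces k by Aᵀk. Both therefore have size ⟨k , Aλ⟩ = ⟨Aᵀk , λ⟩, and the
-- inequalities in the statement say exactly that a partition is the image of a code that is itself a
-- partition. For (4), for instance, A adds 2λₘ to λ₁, and Aᵀ adds 2k₁ to kₘ.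
module Submission where

open import Defs
open import Data.Nat using (ℕ; suc; _+_; _*_; _∸_; _≤_; _<_; z≤n; s≤s)
open import Data.Nat.Properties
open import Data.Nat.Tactic.RingSolver using (solve)
open import Data.List using ([]; _∷_; _++_; _∷ʳ_; length; _∷ʳ′_; initLast)
open import Data.List.Properties using (∷-injective; ∷ʳ-injective; ++-assoc)
import Data.List.Relation.Binary.Pointwise as Pointwise
open import Data.Product using (Σ; ∃-syntax; _×_; _,_; proj₁; proj₂)
open import Data.Product.Properties using (,-injective; Σ-≡,≡→≡)
open import Data.Sum using (_⊎_; inj₁; inj₂)
open import Data.Unit using (tt)
open import Data.Empty using (⊥; ⊥-elim)
open import Function.Base using (id)
open import Function.Bundles using (_↔_; mk↔ₛ′)
open import Function.Properties.Inverse using (↔-trans; ↔-sym)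
open import Relation.Nullary.Irrelevant using (Irrelevant)
open import Relation.Binary.PropositionalEquality

balance-< : ∀ {a b c d} → c < d → a + d ≡ b + c → a < b
balance-< {a} {b} {c} c<d a+d≡b+c =
  +-cancelʳ-< c a b (subst (a + c <_) a+d≡b+c (+-monoʳ-< a c<d))

m≤n⇒∃[o]o+m≡n : ∀ {m n} → m ≤ n → ∃[ o ] o + m ≡ n
m≤n⇒∃[o]o+m≡n {m} {n} m≤n = n ∸ m , m∸n+n≡m m≤n

×-irrelevant : ∀ {A B : Set} → Irrelevant A → Irrelevant B → Irrelevant (A × B)
×-irrelevant A-irr B-irr (a , b) (a′ , b′) = cong₂ _,_ (A-irr a a′) (B-irr b b′)

<×<-irrelevant : ∀ {a b c d} → Irrelevant (a < b × c < d)
<×<-irrelevant = ×-irrelevant ≤-irrelevant ≤-irrelevant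

by-dimension-irrelevant : ∀ {d} {A B : Set} → Irrelevant A → Irrelevant B →
                          Irrelevant ((3 ≤ d × A) ⊎ (d ≡ 2 × B))
by-dimension-irrelevant A-irr _ (inj₁ h) (inj₁ h′) = cong inj₁ (×-irrelevant ≤-irrelevant A-irr h h′)
by-dimension-irrelevant _ B-irr (inj₂ h) (inj₂ h′) = cong inj₂ (×-irrelevant ≡-irrelevant B-irr h h′)
by-dimension-irrelevant _ _ (inj₁ (s≤s (s≤s ()) , _)) (inj₂ (refl , _))
by-dimension-irrelevant _ _ (inj₂ (refl , _)) (inj₁ (s≤s (s≤s ()) , _))

decreasing-irrelevant : ∀ p → Irrelevant (Decreasing p)
decreasing-irrelevant [] tt tt = refl
decreasing-irrelevant (_ ∷ []) = ×-irrelevant ≤-irrelevant ≤-irrelevant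
decreasing-irrelevant (_ ∷ y ∷ r) =
  ×-irrelevant ≤-irrelevant (×-irrelevant ≤-irrelevant (decreasing-irrelevant (y ∷ r)))

-- lam [] 1 = 0, so the head condition reads 0 < a when r is empty.
decreasing-∷⁻ : ∀ {a k} r → Decreasing ((a , k) ∷ r) → lam r 1 < a × 0 < k × Decreasing r
decreasing-∷⁻ [] (0<a , 0<k) = 0<a , 0<k , tt
decreasing-∷⁻ (_ ∷ _) dec = dec

decreasing-∷⁺ : ∀ {a k} r → lam r 1 < a → 0 < k → Decreasing r → Decreasing ((a , k) ∷ r)
decreasing-∷⁺ [] 0<a 0<k _ = 0<a , 0<k
decreasing-∷⁺ (_ ∷ _) λ₂<a 0<k dec = λ₂<a , 0<k , dec

decreasing-∷ʳ⁻ : ∀ x xs {b l} → Decreasing (x ∷ xs ∷ʳ (b , l)) →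
                 Decreasing (x ∷ xs) × b < lamLast (x ∷ xs) × 0 < b × 0 < l
decreasing-∷ʳ⁻ x [] (b<a , 0<k , 0<b , 0<l) = (<-trans 0<b b<a , 0<k) , b<a , 0<b , 0<l
decreasing-∷ʳ⁻ x (y ∷ xs) (λ₂<λ₁ , 0<k , dec) =
  let dec′ , b<λₘ , 0<b , 0<l = decreasing-∷ʳ⁻ y xs dec in (λ₂<λ₁ , 0<k , dec′) , b<λₘ , 0<b , 0<l

decreasing-∷ʳ⁺ : ∀ x xs {b l} → Decreasing (x ∷ xs) → b < lamLast (x ∷ xs) → 0 < b → 0 < l →
                 Decreasing (x ∷ xs ∷ʳ (b , l))
decreasing-∷ʳ⁺ x [] (_ , 0<k) b<a 0<b 0<l = b<a , 0<k , 0<b , 0<l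
decreasing-∷ʳ⁺ x (y ∷ xs) (λ₂<λ₁ , 0<k , dec) b<λₘ 0<b 0<l =
  λ₂<λ₁ , 0<k , decreasing-∷ʳ⁺ y xs dec b<λₘ 0<b 0<l

decreasing-replaceFirstPart : ∀ r {a a′ k} → Decreasing ((a , k) ∷ r) → lam r 1 < a′ →
                              Decreasing ((a′ , k) ∷ r)
decreasing-replaceFirstPart r dec λ₂<a′ =
  let _ , 0<k , dec-r = decreasing-∷⁻ r dec in decreasing-∷⁺ r λ₂<a′ 0<k dec-r

SameParts : Part → Part → Set
SameParts = Pointwise.Pointwise (λ x y → proj₁ x ≡ proj₁ y × (0 < proj₂ x → 0 < proj₂ y))

module _ where
  open Pointwise using ([]; _∷_)

  decreasing-sameParts : ∀ {p q} → SameParts p q → Decreasing p → Decreasing q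
  decreasing-sameParts [] tt = tt
  decreasing-sameParts ((refl , pos) ∷ []) (0<a , 0<k) = 0<a , pos 0<k
  decreasing-sameParts ((refl , pos) ∷ same@((refl , _) ∷ _)) (b<a , 0<k , dec) =
    b<a , pos 0<k , decreasing-sameParts same dec

  sameParts-refl : ∀ ms → SameParts ms ms
  sameParts-refl ms = Pointwise.refl (refl , id)

  sameParts-∷ʳ : ∀ {xs ys b l l′} → SameParts xs ys → (0 < l → 0 < l′) →
                 SameParts (xs ∷ʳ (b , l)) (ys ∷ʳ (b , l′))
  sameParts-∷ʳ same pos = Pointwise.++⁺ same ((refl , pos) ∷ [])

  sameParts-ends : ∀ {a k k′ b l l′} ms → (0 < k → 0 < k′) → (0 < l → 0 < l′) →
                   SameParts ((a , k) ∷ ms ∷ʳ (b , l)) ((a , k′) ∷ ms ∷ʳ (b , l′))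
  sameParts-ends ms pos₁ posₘ = (refl , pos₁) ∷ sameParts-∷ʳ (sameParts-refl ms) posₘ

  sameParts-ends₂ : ∀ {a k k′ c j j′ b l l′} ms → (0 < k → 0 < k′) → (0 < j → 0 < j′) → (0 < l → 0 < l′) →
                    SameParts ((a , k) ∷ ms ∷ʳ (c , j) ∷ʳ (b , l)) ((a , k′) ∷ ms ∷ʳ (c , j′) ∷ʳ (b , l′))
  sameParts-ends₂ ms pos₁ posₘ₋₁ posₘ =
    (refl , pos₁) ∷ sameParts-∷ʳ (sameParts-∷ʳ (sameParts-refl ms) posₘ₋₁) posₘ

dim-∷ʳ : ∀ xs {y} → dim (xs ∷ʳ y) ≡ suc (dim xs)
dim-∷ʳ []       = refl
dim-∷ʳ (_ ∷ xs) = cong suc (dim-∷ʳ xs)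

lam-++-∷ : ∀ xs {b l ys} → lam (xs ++ (b , l) ∷ ys) (suc (length xs)) ≡ b
lam-++-∷ []           = refl
lam-++-∷ (_ ∷ xs)     = lam-++-∷ xs

mul-++-∷ : ∀ xs {b l ys} → mul (xs ++ (b , l) ∷ ys) (suc (length xs)) ≡ l
mul-++-∷ []           = refl
mul-++-∷ (_ ∷ xs)     = mul-++-∷ xs

lamLast-∷ʳ : ∀ xs {b l} → lamLast (xs ∷ʳ (b , l)) ≡ b
lamLast-∷ʳ xs = trans (cong (lam (xs ∷ʳ _)) (dim-∷ʳ xs)) (lam-++-∷ xs)

mulLast-∷ʳ : ∀ xs {b l} → mulLast (xs ∷ʳ (b , l)) ≡ l
mulLast-∷ʳ xs = trans (cong (mul (xs ∷ʳ _)) (dim-∷ʳ xs)) (mul-++-∷ xs)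

mulPenult-∷ʳ : ∀ xs {c j y} → mulPenult (xs ∷ʳ (c , j) ∷ʳ y) ≡ j
mulPenult-∷ʳ xs {c} {j} {y} = begin
  mul (xs ∷ʳ (c , j) ∷ʳ y) (dim (xs ∷ʳ (c , j) ∷ʳ y) ∸ 1)
    ≡⟨ cong (λ i → mul (xs ∷ʳ (c , j) ∷ʳ y) (i ∸ 1)) (trans (dim-∷ʳ (xs ∷ʳ _)) (cong suc (dim-∷ʳ xs))) ⟩
  mul (xs ∷ʳ (c , j) ∷ʳ y) (suc (length xs))
    ≡⟨ cong (λ q → mul q (suc (length xs))) (++-assoc xs _ _) ⟩
  mul (xs ++ (c , j) ∷ y ∷ []) (suc (length xs))
    ≡⟨ mul-++-∷ xs ⟩
  j ∎
  where open ≡-Reasoning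

size-++ : ∀ xs ys → size (xs ++ ys) ≡ size xs + size ys
size-++ []             ys = refl
size-++ ((a , k) ∷ xs) ys = trans (cong (k * a +_) (size-++ xs ys)) (sym (+-assoc (k * a) _ _))

size-middle : ∀ xs ms ys → size (xs ++ ms ++ ys) ≡ size (xs ++ ys) + size ms
size-middle []             ms ys = trans (size-++ ms ys) (+-comm (size ms) (size ys))
size-middle ((a , k) ∷ xs) ms ys =
  trans (cong (k * a +_) (size-middle xs ms ys)) (sym (+-assoc (k * a) _ _))

size-ends₂ : ∀ x ms y z → size (x ∷ ms ∷ʳ y ∷ʳ z) ≡ size (x ∷ y ∷ z ∷ []) + size ms
size-ends₂ x ms y z = trans (cong (λ r → size (x ∷ r)) (++-assoc ms (y ∷ []) (z ∷ [])))
                            (size-middle (x ∷ []) ms (y ∷ z ∷ []))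

2≤dim-ends : ∀ x ms y → 2 ≤ dim (x ∷ ms ∷ʳ y)
2≤dim-ends _ ms _ = s≤s (subst (1 ≤_) (sym (dim-∷ʳ ms)) (s≤s z≤n))

3≤dim-ends₂ : ∀ x ms y z → 3 ≤ dim (x ∷ ms ∷ʳ y ∷ʳ z)
3≤dim-ends₂ _ ms _ _ =
  s≤s (subst (2 ≤_) (sym (trans (dim-∷ʳ (ms ∷ʳ _)) (cong suc (dim-∷ʳ ms)))) (s≤s (s≤s z≤n)))

≢-by-dim : ∀ {p q} → dim p ≡ 2 → 3 ≤ dim q → p ≢ q
≢-by-dim dim≡2 3≤dim refl with subst (3 ≤_) dim≡2 3≤dim
... | s≤s (s≤s ())

mul₁<mulLast⇒2≤dim : ∀ {p} → mul p 1 < mulLast p → 2 ≤ dim p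
mul₁<mulLast⇒2≤dim {[]} ()
mul₁<mulLast⇒2≤dim {_ ∷ []} k<k = ⊥-elim (<-irrefl refl k<k)
mul₁<mulLast⇒2≤dim {_ ∷ _ ∷ _} _ = s≤s (s≤s z≤n)

Pair Ends Ends₂ : Set
Pair  = (ℕ × ℕ) × (ℕ × ℕ)
Ends  = (ℕ × ℕ) × Part × (ℕ × ℕ)
Ends₂ = (ℕ × ℕ) × Part × (ℕ × ℕ) × (ℕ × ℕ)

pairShape : Pair → Part
pairShape (x , y) = x ∷ y ∷ []

endsShape : Ends → Part
endsShape (x , ms , y) = x ∷ ms ∷ʳ y

ends₂Shape : Ends₂ → Part
ends₂Shape (x , ms , y , z) = x ∷ ms ∷ʳ y ∷ʳ z

pair⊎ends₂Shape : Pair ⊎ Ends₂ → Part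
pair⊎ends₂Shape (inj₁ c) = pairShape c
pair⊎ends₂Shape (inj₂ c) = ends₂Shape c

pairShape-surjective : ∀ p → dim p ≡ 2 → ∃[ c ] pairShape c ≡ p
pairShape-surjective (x ∷ y ∷ []) _ = (x , y) , refl

endsShape-surjective : ∀ p → 2 ≤ dim p → ∃[ c ] endsShape c ≡ p
endsShape-surjective (x ∷ r) 2≤m with initLast r
endsShape-surjective (x ∷ .[]) (s≤s ()) | []
... | ms ∷ʳ′ y = (x , ms , y) , refl

ends₂Shape-surjective : ∀ p → 3 ≤ dim p → ∃[ c ] ends₂Shape c ≡ p
ends₂Shape-surjective p 3≤m with endsShape-surjective p (≤-trans (n≤1+n 2) 3≤m)
... | (x , r , z) , refl with initLast r
ends₂Shape-surjective _ (s≤s (s≤s ())) | (x , .[] , z) , refl | []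
... | ms ∷ʳ′ y = (x , ms , y , z) , refl

∷²-injective : ∀ {x x′ y y′ : ℕ × ℕ} {r r′} → x ∷ y ∷ r ≡ x′ ∷ y′ ∷ r′ → x ≡ x′ × y ≡ y′ × r ≡ r′
∷²-injective refl = refl , refl , refl

ends-injective : ∀ {x x′ y y′ : ℕ × ℕ} ms ms′ → x ∷ ms ∷ʳ y ≡ x′ ∷ ms′ ∷ʳ y′ → x ≡ x′ × ms ≡ ms′ × y ≡ y′
ends-injective ms ms′ eq with ∷-injective eq
... | x≡x′ , tail≡ with ∷ʳ-injective ms ms′ tail≡
... | ms≡ms′ , y≡y′ = x≡x′ , ms≡ms′ , y≡y′

ends₂-injective : ∀ {x x′ y y′ z z′ : ℕ × ℕ} ms ms′ → x ∷ ms ∷ʳ y ∷ʳ z ≡ x′ ∷ ms′ ∷ʳ y′ ∷ʳ z′ →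
                  x ≡ x′ × ms ≡ ms′ × y ≡ y′ × z ≡ z′
ends₂-injective ms ms′ eq with ends-injective (ms ∷ʳ _) (ms′ ∷ʳ _) eq
... | x≡x′ , init≡ , z≡z′ with ∷ʳ-injective ms ms′ init≡
... | ms≡ms′ , y≡y′ = x≡x′ , ms≡ms′ , y≡y′ , z≡z′

IsPartition : Part → Set
IsPartition p = 1 ≤ dim p × Decreasing p

record Parametrisation {C : Set} (shape encode : C → Part) (P : Part → Set) : Set where
  field
    injective : ∀ {c c′} → encode c ≡ encode c′ → c ≡ c′
    sound     : ∀ {c} → Decreasing (shape c) → IsPartition (encode c) × P (encode c)
    complete  : ∀ {p} → IsPartition p → P p → ∃[ c ] Decreasing (shape c) × encode c ≡ p

module _ {C : Set} {shape encode : C → Part} {P : Part → Set}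
         (P-irrelevant : ∀ p → Irrelevant (P p)) (param : Parametrisation shape encode P)
         (weight : C → ℕ) (size-encode : ∀ c → size (encode c) ≡ weight c) (n : ℕ) where
  open Parametrisation param

  partitionsWith↔codes : PartitionsWith n P ↔ Σ C (λ c → Decreasing (shape c) × weight c ≡ n)
  partitionsWith↔codes = mk↔ₛ′ to from to∘from from∘to
    where
    to : PartitionsWith n P → Σ C (λ c → Decreasing (shape c) × weight c ≡ n)
    to (p , (1≤m , dec , size≡n) , Pp) =
      let c , dec-c , encode≡p = complete (1≤m , dec) Pp
      in c , dec-c , trans (sym (size-encode c)) (trans (cong size encode≡p) size≡n)

    from : Σ C (λ c → Decreasing (shape c) × weight c ≡ n) → PartitionsWith n P
    from (c , dec-c , weight≡n) =
      let (1≤m , dec) , Pp = sound dec-c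
      in encode c , (1≤m , dec , trans (size-encode c) weight≡n) , Pp

    to∘from : ∀ c → to (from c) ≡ c
    to∘from (c , dec-c , _) =
      Σ-≡,≡→≡ (injective (proj₂ (proj₂ (complete _ _))) ,
               ×-irrelevant (decreasing-irrelevant (shape c)) ≡-irrelevant _ _)

    from∘to : ∀ p → from (to p) ≡ p
    from∘to (p , _) =
      Σ-≡,≡→≡ (proj₂ (proj₂ (complete _ _)) ,
               ×-irrelevant (×-irrelevant ≤-irrelevant
                                          (×-irrelevant (decreasing-irrelevant p) ≡-irrelevant))
                            (P-irrelevant p) _ _)

partitionsWith-↔ : ∀ {C : Set} {shape encodeP encodeQ : C → Part} {P Q : Part → Set} →
  (∀ p → Irrelevant (P p)) → (∀ p → Irrelevant (Q p)) →
  Parametrisation shape encodeP P → Parametrisation shape encodeQ Q →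
  (∀ c → size (encodeP c) ≡ size (encodeQ c)) →
  ∀ n → PartitionsWith n P ↔ PartitionsWith n Q
partitionsWith-↔ {encodeP = encodeP} P-irr Q-irr paramP paramQ size≡ n =
  ↔-trans (partitionsWith↔codes P-irr paramP (λ c → size (encodeP c)) (λ _ → refl) n)
          (↔-sym (partitionsWith↔codes Q-irr paramQ (λ c → size (encodeP c)) (λ c → sym (size≡ c)) n))

module Bijection4 where

  encodeL encodeR : Ends → Part
  encodeL ((a , k) , ms , (b , l)) = (a + 2 * b , k) ∷ ms ∷ʳ (b , l)
  encodeR ((a , k) , ms , (b , l)) = (a , k) ∷ ms ∷ʳ (b , l + 2 * k)

  parametrisationL : Parametrisation endsShape encodeL cond4L
  parametrisationL = record { injective = injective ; sound = sound ; complete = complete }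
    where
    injective : ∀ {c c′} → encodeL c ≡ encodeL c′ → c ≡ c′
    injective {(a , _) , ms , (b , _)} {(a′ , _) , ms′ , _} eq with ends-injective ms ms′ eq
    ... | first≡ , refl , refl with ,-injective first≡
    ... | λ₁≡ , refl with +-cancelʳ-≡ (2 * b) a a′ λ₁≡
    ... | refl = refl

    sound : ∀ {c} → Decreasing (endsShape c) → IsPartition (encodeL c) × cond4L (encodeL c)
    sound {(a , k) , ms , (b , l)} dec =
      (s≤s z≤n , decreasing-replaceFirstPart (ms ∷ʳ (b , l)) dec (<-≤-trans λ₂<a (m≤m+n a (2 * b)))) ,
      2≤dim-ends (a + 2 * b , k) ms (b , l) ,
      subst (λ λₘ → lam (ms ∷ʳ (b , l)) 1 + 2 * λₘ < a + 2 * b)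
            (sym (lamLast-∷ʳ ((a + 2 * b , k) ∷ ms))) (+-monoˡ-< (2 * b) λ₂<a)
      where
      λ₂<a : lam (ms ∷ʳ (b , l)) 1 < a
      λ₂<a = proj₁ (decreasing-∷⁻ (ms ∷ʳ (b , l)) dec)

    complete : ∀ {p} → IsPartition p → cond4L p → ∃[ c ] Decreasing (endsShape c) × encodeL c ≡ p
    complete {p} (_ , dec) (2≤m , gap) with endsShape-surjective p 2≤m
    ... | ((d , k) , ms , (b , l)) , refl rewrite lamLast-∷ʳ ((d , k) ∷ ms) {b} {l}
      with m≤n⇒∃[o]o+m≡n (≤-trans (m≤n+m (2 * b) (lam (ms ∷ʳ (b , l)) 1)) (<⇒≤ gap))
    ... | a , refl =
      ((a , k) , ms , (b , l)) ,
      decreasing-replaceFirstPart (ms ∷ʳ (b , l)) dec (+-cancelʳ-< (2 * b) _ a gap) ,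
      refl

  parametrisationR : Parametrisation endsShape encodeR cond4R
  parametrisationR = record { injective = injective ; sound = sound ; complete = complete }
    where
    injective : ∀ {c c′} → encodeR c ≡ encodeR c′ → c ≡ c′
    injective {(_ , k) , ms , (_ , l)} {_ , ms′ , (_ , l′)} eq with ends-injective ms ms′ eq
    ... | refl , refl , last≡ with ,-injective last≡
    ... | refl , kₘ≡ with +-cancelʳ-≡ (2 * k) l l′ kₘ≡
    ... | refl = refl

    sound : ∀ {c} → Decreasing (endsShape c) → IsPartition (encodeR c) × cond4R (encodeR c)
    sound {(a , k) , ms , (b , l)} dec =
      (s≤s z≤n , decreasing-sameParts (sameParts-ends ms id (λ 0<l → <-≤-trans 0<l (m≤m+n l _))) dec) ,
      subst (2 * k <_) (sym (mulLast-∷ʳ ((a , k) ∷ ms))) (m<n+m (2 * k) 0<l)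
      where
      0<l : 0 < l
      0<l = proj₂ (proj₂ (proj₂ (decreasing-∷ʳ⁻ (a , k) ms dec)))

    complete : ∀ {p} → IsPartition p → cond4R p → ∃[ c ] Decreasing (endsShape c) × encodeR c ≡ p
    complete {p} (_ , dec) 2k<kₘ
      with endsShape-surjective p (mul₁<mulLast⇒2≤dim {p} (≤-<-trans (m≤m+n (mul p 1) _) 2k<kₘ))
    ... | ((a , k) , ms , (b , kₘ)) , refl rewrite mulLast-∷ʳ ((a , k) ∷ ms) {b} {kₘ}
      with m≤n⇒∃[o]o+m≡n (<⇒≤ 2k<kₘ)
    ... | l , refl =
      ((a , k) , ms , (b , l)) ,
      decreasing-sameParts (sameParts-ends ms id (λ _ → +-cancelʳ-< (2 * k) 0 l 2k<kₘ)) dec , refl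

  size≡ : ∀ c → size (encodeL c) ≡ size (encodeR c)
  size≡ ((a , k) , ms , (b , l)) = begin
    size ((a + 2 * b , k) ∷ ms ∷ʳ (b , l))
      ≡⟨ size-middle ((a + 2 * b , k) ∷ []) ms ((b , l) ∷ []) ⟩
    k * (a + 2 * b) + (l * b + 0) + size ms
      ≡⟨ cong (_+ size ms) (solve (a ∷ b ∷ k ∷ l ∷ [])) ⟩
    k * a + ((l + 2 * k) * b + 0) + size ms
      ≡⟨ sym (size-middle ((a , k) ∷ []) ms ((b , l + 2 * k) ∷ [])) ⟩
    size ((a , k) ∷ ms ∷ʳ (b , l + 2 * k)) ∎
    where open ≡-Reasoning

  cond4L↔cond4R : ∀ n → PartitionsWith n cond4L ↔ PartitionsWith n cond4R
  cond4L↔cond4R =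
    partitionsWith-↔ (λ _ → <×<-irrelevant) (λ _ → ≤-irrelevant) parametrisationL parametrisationR size≡

module Bijection2 where

  encodeL encodeR : Ends → Part
  encodeL ((a , x) , ms , (b , y)) = (b + (a + b) , x) ∷ (a + b , y) ∷ ms
  encodeR ((a , x) , ms , (b , y)) = (a , y + x) ∷ ms ∷ʳ (b , x + (y + x))

  parametrisationL : Parametrisation endsShape encodeL cond2L
  parametrisationL = record { injective = injective ; sound = sound ; complete = complete }
    where
    injective : ∀ {c c′} → encodeL c ≡ encodeL c′ → c ≡ c′
    injective {(a , _) , _ , (b , _)} {(a′ , _) , _ , (b′ , _)} eq with ∷²-injective eq
    ... | first≡ , second≡ , refl with ,-injective first≡ | ,-injective second≡
    ... | λ₁≡ , refl | λ₂≡ , refl with +-cancelʳ-≡ (a + b) b b′ (trans λ₁≡ (cong (b′ +_) (sym λ₂≡)))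
    ... | refl with +-cancelʳ-≡ b a a′ λ₂≡
    ... | refl = refl

    sound : ∀ {c} → Decreasing (endsShape c) → IsPartition (encodeL c) × cond2L (encodeL c)
    sound {(a , x) , ms , (b , y)} dec with decreasing-∷ʳ⁻ (a , x) ms dec
    ... | dec-init , b<λₘ , 0<b , 0<y with decreasing-∷⁻ ms dec-init
    ... | λ₃<a , 0<x , dec-ms =
      (s≤s z≤n , m<n+m (a + b) 0<b , 0<x , decreasing-∷⁺ ms (<-≤-trans λ₃<a (m≤m+n a b)) 0<y dec-ms) ,
      cond ms λ₃<a b<λₘ
      where
      cond : ∀ ms → lam ms 1 < a → b < lamLast ((a , x) ∷ ms) → cond2L (encodeL ((a , x) , ms , (b , y)))
      cond [] 0<a b<a =
        inj₂ (refl , balance-< {b + (a + b)} {2 * (a + b)} 0<a (solve (a ∷ b ∷ [])) ,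
                    balance-< {2 * (b + (a + b))} {3 * (a + b)} {b} {a} b<a (solve (a ∷ b ∷ [])))
      cond ((e , z) ∷ ms) e<a b<λₘ =
        inj₁ (s≤s (s≤s (s≤s z≤n)) ,
              subst (_< a + b + lamLast ((e , z) ∷ ms)) (+-comm (a + b) b) (+-monoʳ-< (a + b) b<λₘ) ,
              balance-< {b + (a + b) + e} {2 * (a + b)} e<a (solve (a ∷ b ∷ e ∷ [])))

    λ₁-λ₂<λ₂ : ∀ {b d₂} x y ms → cond2L ((b + d₂ , x) ∷ (d₂ , y) ∷ ms) → b < d₂
    λ₁-λ₂<λ₂ {b} {d₂} _ _ _ (inj₂ (_ , λ₁<2λ₂ , _)) =
      balance-< {b} {d₂} {b + d₂} {2 * d₂} λ₁<2λ₂ (solve (b ∷ d₂ ∷ []))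
    λ₁-λ₂<λ₂ {b} {d₂} _ _ _ (inj₁ (_ , _ , λ₁+λ₃<2λ₂)) =
      balance-< {b} {d₂} {b + d₂} {2 * d₂} (≤-<-trans (m≤m+n (b + d₂) _) λ₁+λ₃<2λ₂) (solve (b ∷ d₂ ∷ []))

    code-decreasing : ∀ {a b x y} ms → 0 < x → 0 < b → Decreasing ((a + b , y) ∷ ms) →
            cond2L ((b + (a + b) , x) ∷ (a + b , y) ∷ ms) → Decreasing ((a , x) ∷ ms ∷ʳ (b , y))
    code-decreasing {a} {b} [] 0<x 0<b (_ , 0<y) (inj₂ (_ , _ , 2λ₁<3λ₂)) =
      balance-< {b} {a} {2 * (b + (a + b))} {3 * (a + b)} 2λ₁<3λ₂ (solve (a ∷ b ∷ [])) , 0<x , 0<b , 0<y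
    code-decreasing {a} {b} {x} ((e , z) ∷ ms) 0<x 0<b (_ , 0<y , dec-ms) (inj₁ (_ , λ₁<λ₂+λₘ , λ₁+λ₃<2λ₂)) =
      decreasing-∷ʳ⁺ (a , x) ((e , z) ∷ ms)
        (balance-< {e} {a} {b + (a + b) + e} {2 * (a + b)} λ₁+λ₃<2λ₂ (solve (a ∷ b ∷ e ∷ [])) ,
         0<x , dec-ms)
        (+-cancelˡ-< (a + b) b (lamLast ((e , z) ∷ ms))
          (subst (_< a + b + lamLast ((e , z) ∷ ms)) (+-comm b (a + b)) λ₁<λ₂+λₘ)) 0<b 0<y
    code-decreasing [] _ _ _ (inj₁ (s≤s (s≤s ()) , _))
    code-decreasing (_ ∷ _) _ _ _ (inj₂ (() , _))

    complete : ∀ {p} → IsPartition p → cond2L p → ∃[ c ] Decreasing (endsShape c) × encodeL c ≡ p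
    complete {[]} (() , _) _
    complete {_ ∷ []} _ (inj₁ (s≤s () , _))
    complete {_ ∷ []} _ (inj₂ (() , _))
    complete {(d₁ , x) ∷ (d₂ , y) ∷ ms} (_ , d₂<d₁ , 0<x , dec) cond
      with m≤n⇒∃[o]o+m≡n (<⇒≤ d₂<d₁)
    ... | b , refl with m≤n⇒∃[o]o+m≡n (<⇒≤ (λ₁-λ₂<λ₂ x y ms cond))
    ... | a , refl =
      ((a , x) , ms , (b , y)) , code-decreasing ms 0<x (+-cancelʳ-< (a + b) 0 b d₂<d₁) dec cond , refl

  parametrisationR : Parametrisation endsShape encodeR cond2R
  parametrisationR = record { injective = injective ; sound = sound ; complete = complete }
    where
    injective : ∀ {c c′} → encodeR c ≡ encodeR c′ → c ≡ c′
    injective {(_ , x) , ms , (_ , y)} {(_ , x′) , ms′ , (_ , y′)} eq with ends-injective ms ms′ eq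
    ... | first≡ , refl , last≡ with ,-injective first≡ | ,-injective last≡
    ... | refl , k₁≡ | refl , kₘ≡ with +-cancelʳ-≡ (y + x) x x′ (trans kₘ≡ (cong (x′ +_) (sym k₁≡)))
    ... | refl with +-cancelʳ-≡ x y y′ k₁≡
    ... | refl = refl

    sound : ∀ {c} → Decreasing (endsShape c) → IsPartition (encodeR c) × cond2R (encodeR c)
    sound {(a , x) , ms , (b , y)} dec =
      (s≤s z≤n , decreasing-sameParts (sameParts-ends ms (λ _ → m<n⇒0<n (m<n+m x 0<y))
                                                        (λ _ → m<n⇒0<n (m<n+m (y + x) 0<x))) dec) ,
      subst (λ kₘ → y + x < kₘ × kₘ < 2 * (y + x)) (sym (mulLast-∷ʳ ((a , y + x) ∷ ms)))
            (m<n+m (y + x) 0<x , balance-< {x + (y + x)} {2 * (y + x)} {0} {y} 0<y (solve (x ∷ y ∷ [])))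
      where
      0<x : 0 < x
      0<x = proj₁ (proj₂ (decreasing-∷⁻ (ms ∷ʳ (b , y)) dec))
      0<y : 0 < y
      0<y = proj₂ (proj₂ (proj₂ (decreasing-∷ʳ⁻ (a , x) ms dec)))

    complete : ∀ {p} → IsPartition p → cond2R p → ∃[ c ] Decreasing (endsShape c) × encodeR c ≡ p
    complete {p} (_ , dec) (k₁<kₘ , kₘ<2k₁) with endsShape-surjective p (mul₁<mulLast⇒2≤dim {p} k₁<kₘ)
    ... | ((a , k₁) , ms , (b , kₘ)) , refl rewrite mulLast-∷ʳ ((a , k₁) ∷ ms) {b} {kₘ}
      with m≤n⇒∃[o]o+m≡n (<⇒≤ k₁<kₘ)
    ... | x , refl
      with m≤n⇒∃[o]o+m≡n (<⇒≤ (balance-< {x} {k₁} {x + k₁} {2 * k₁} kₘ<2k₁ (solve (x ∷ k₁ ∷ []))))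
    ... | y , refl =
      ((a , x) , ms , (b , y)) ,
      decreasing-sameParts (sameParts-ends ms (λ _ → +-cancelʳ-< (y + x) 0 x k₁<kₘ) (λ _ → 0<y)) dec ,
      refl
      where
      0<y : 0 < y
      0<y = balance-< {0} {y} {x + (y + x)} {2 * (y + x)} kₘ<2k₁ (solve (x ∷ y ∷ []))

  size≡ : ∀ c → size (encodeL c) ≡ size (encodeR c)
  size≡ ((a , x) , ms , (b , y)) = begin
    size ((b + (a + b) , x) ∷ (a + b , y) ∷ ms)
      ≡⟨ size-++ ((b + (a + b) , x) ∷ (a + b , y) ∷ []) ms ⟩
    x * (b + (a + b)) + (y * (a + b) + 0) + size ms
      ≡⟨ cong (_+ size ms) (solve (a ∷ b ∷ x ∷ y ∷ [])) ⟩
    (y + x) * a + ((x + (y + x)) * b + 0) + size ms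
      ≡⟨ sym (size-middle ((a , y + x) ∷ []) ms ((b , x + (y + x)) ∷ [])) ⟩
    size ((a , y + x) ∷ ms ∷ʳ (b , x + (y + x))) ∎
    where open ≡-Reasoning

  cond2L↔cond2R : ∀ n → PartitionsWith n cond2L ↔ PartitionsWith n cond2R
  cond2L↔cond2R = partitionsWith-↔
    (λ _ → by-dimension-irrelevant <×<-irrelevant <×<-irrelevant)
    (λ _ → <×<-irrelevant) parametrisationL parametrisationR size≡

module Bijection1 where

  encodeL encodeR : Pair ⊎ Ends₂ → Part
  encodeL (inj₁ ((x , t₁) , (y , t₂))) = (x + (y + x) , t₁) ∷ (y + x , t₂) ∷ []
  encodeL (inj₂ ((a , t₃) , ms , (c , t₁) , (b , t₂))) = (c + (b + a) , t₁) ∷ (b + a , t₂) ∷ (a , t₃) ∷ ms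
  encodeR (inj₁ ((x , t₁) , (y , t₂))) = (x , t₁ + (t₂ + t₁)) ∷ (y , t₂ + t₁) ∷ []
  encodeR (inj₂ ((a , t₃) , ms , (c , t₁) , (b , t₂))) =
    (a , t₃ + (t₂ + t₁)) ∷ ms ∷ʳ (c , t₁) ∷ʳ (b , t₂ + t₁)

  parametrisationL : Parametrisation pair⊎ends₂Shape encodeL cond1L
  parametrisationL = record { injective = injective ; sound = sound ; complete = complete }
    where
    injective : ∀ {c c′} → encodeL c ≡ encodeL c′ → c ≡ c′
    injective {inj₁ ((x , _) , (y , _))} {inj₁ ((x′ , _) , (y′ , _))} eq with ∷²-injective eq
    ... | first≡ , second≡ , _ with ,-injective first≡ | ,-injective second≡
    ... | λ₁≡ , refl | λ₂≡ , refl with +-cancelʳ-≡ (y + x) x x′ (trans λ₁≡ (cong (x′ +_) (sym λ₂≡)))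
    ... | refl with +-cancelʳ-≡ x y y′ λ₂≡
    ... | refl = refl
    injective {inj₂ ((a , _) , _ , (c , _) , (b , _))} {inj₂ (_ , _ , (c′ , _) , (b′ , _))} eq
      with ∷²-injective eq
    ... | first≡ , second≡ , refl with ,-injective first≡ | ,-injective second≡
    ... | λ₁≡ , refl | λ₂≡ , refl with +-cancelʳ-≡ a b b′ λ₂≡
    ... | refl with +-cancelʳ-≡ (b + a) c c′ λ₁≡
    ... | refl = refl
    injective {inj₁ _} {inj₂ _} eq with ∷²-injective eq
    ... | _ , _ , ()
    injective {inj₂ _} {inj₁ _} eq with ∷²-injective eq
    ... | _ , _ , ()

    sound : ∀ {c} → Decreasing (pair⊎ends₂Shape c) → IsPartition (encodeL c) × cond1L (encodeL c)
    sound {inj₁ ((x , t₁) , (y , t₂))} (y<x , 0<t₁ , 0<y , 0<t₂) =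
      (s≤s z≤n , m<n+m (y + x) (<-trans 0<y y<x) , 0<t₁ , <-≤-trans 0<y (m≤m+n y x) , 0<t₂) ,
      inj₂ (refl , balance-< {x + (y + x)} {2 * (y + x)} {0} {y} 0<y (solve (x ∷ y ∷ [])) ,
                   balance-< {3 * (y + x)} {2 * (x + (y + x))} {y} {x} y<x (solve (x ∷ y ∷ [])))
    sound {inj₂ ((a , t₃) , ms , (c , t₁) , (b , t₂))} dec
      with decreasing-∷ʳ⁻ (a , t₃) (ms ∷ʳ (c , t₁)) dec
    ... | dec-init , b<c , 0<b , 0<t₂ rewrite lamLast-∷ʳ ((a , t₃) ∷ ms) {c} {t₁}
      with decreasing-∷ʳ⁻ (a , t₃) ms dec-init
    ... | dec-ms , c<λₘ , 0<c , 0<t₁ =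
      (s≤s z≤n , m<n+m (b + a) 0<c , 0<t₁ , m<n+m a 0<b , 0<t₂ , dec-ms) ,
      inj₁ (s≤s (s≤s (s≤s z≤n)) ,
            subst (_< b + a + lamLast ((a , t₃) ∷ ms)) (+-comm (b + a) c) (+-monoʳ-< (b + a) c<λₘ) ,
            balance-< {2 * (b + a)} {c + (b + a) + a} {b} {c} b<c (solve (a ∷ b ∷ c ∷ [])))

    complete : ∀ {p} → IsPartition p → cond1L p → ∃[ c ] Decreasing (pair⊎ends₂Shape c) × encodeL c ≡ p
    complete {p} (_ , dec) (inj₂ (dim≡2 , λ₁<2λ₂ , 3λ₂<2λ₁)) with pairShape-surjective p dim≡2
    ... | ((d₁ , t₁) , (d₂ , t₂)) , refl with dec
    ... | d₂<d₁ , 0<t₁ , _ , 0<t₂ with m≤n⇒∃[o]o+m≡n (<⇒≤ d₂<d₁)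
    ... | x , refl
      with m≤n⇒∃[o]o+m≡n (<⇒≤ (balance-< {x} {d₂} {x + d₂} {2 * d₂} λ₁<2λ₂ (solve (x ∷ d₂ ∷ []))))
    ... | y , refl =
      inj₁ ((x , t₁) , (y , t₂)) ,
      (balance-< {y} {x} {3 * (y + x)} {2 * (x + (y + x))} 3λ₂<2λ₁ (solve (x ∷ y ∷ [])) , 0<t₁ ,
       +-cancelʳ-< x 0 y (balance-< {x} {y + x} {x + (y + x)} {2 * (y + x)} λ₁<2λ₂ (solve (x ∷ y ∷ []))) ,
       0<t₂) ,
      refl
    complete {(d₁ , t₁) ∷ (d₂ , t₂) ∷ (a , t₃) ∷ ms} (_ , d₂<d₁ , 0<t₁ , a<d₂ , 0<t₂ , dec-ms)
             (inj₁ (_ , λ₁<λ₂+λₘ , 2λ₂<λ₁+λ₃))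
      with m≤n⇒∃[o]o+m≡n (<⇒≤ a<d₂)
    ... | b , refl with m≤n⇒∃[o]o+m≡n (<⇒≤ d₂<d₁)
    ... | c , refl =
      inj₂ ((a , t₃) , ms , (c , t₁) , (b , t₂)) ,
      decreasing-∷ʳ⁺ (a , t₃) (ms ∷ʳ (c , t₁))
        (decreasing-∷ʳ⁺ (a , t₃) ms dec-ms c<λₘ (+-cancelʳ-< (b + a) 0 c d₂<d₁) 0<t₁)
        (subst (b <_) (sym (lamLast-∷ʳ ((a , t₃) ∷ ms)))
               (balance-< {b} {c} {2 * (b + a)} {c + (b + a) + a} 2λ₂<λ₁+λ₃ (solve (a ∷ b ∷ c ∷ []))))
        (+-cancelʳ-< a 0 b a<d₂) 0<t₂ ,
      refl
      where
      c<λₘ : c < lamLast ((a , t₃) ∷ ms)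
      c<λₘ = +-cancelˡ-< (b + a) c _
               (subst (_< b + a + lamLast ((a , t₃) ∷ ms)) (+-comm c (b + a)) λ₁<λ₂+λₘ)
    complete {_ ∷ _ ∷ []} _ (inj₁ (s≤s (s≤s ()) , _))
    complete {_ ∷ []} _ (inj₁ (s≤s () , _))
    complete {[]} (() , _) _

  parametrisationR : Parametrisation pair⊎ends₂Shape encodeR cond1R
  parametrisationR = record { injective = injective ; sound = sound ; complete = complete }
    where
    injective : ∀ {c c′} → encodeR c ≡ encodeR c′ → c ≡ c′
    injective {inj₁ ((_ , t₁) , (_ , t₂))} {inj₁ ((_ , t₁′) , (_ , t₂′))} eq with ∷²-injective eq
    ... | first≡ , second≡ , _ with ,-injective first≡ | ,-injective second≡
    ... | refl , k₁≡ | refl , k₂≡ with +-cancelʳ-≡ (t₂ + t₁) t₁ t₁′ (trans k₁≡ (cong (t₁′ +_) (sym k₂≡)))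
    ... | refl with +-cancelʳ-≡ t₁ t₂ t₂′ k₂≡
    ... | refl = refl
    injective {inj₂ ((_ , t₃) , ms , (_ , t₁) , (_ , t₂))} {inj₂ ((_ , t₃′) , ms′ , _ , (_ , t₂′))} eq
      with ends₂-injective ms ms′ eq
    ... | first≡ , refl , refl , last≡ with ,-injective first≡ | ,-injective last≡
    ... | refl , k₁≡ | refl , kₘ≡ with +-cancelʳ-≡ t₁ t₂ t₂′ kₘ≡
    ... | refl with +-cancelʳ-≡ (t₂ + t₁) t₃ t₃′ k₁≡
    ... | refl = refl
    injective {inj₁ _} {inj₂ ((a , t₃) , ms , (c , t₁) , (b , t₂))} eq =
      ⊥-elim (≢-by-dim refl (3≤dim-ends₂ (a , t₃ + (t₂ + t₁)) ms (c , t₁) (b , t₂ + t₁)) eq)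
    injective {inj₂ ((a , t₃) , ms , (c , t₁) , (b , t₂))} {inj₁ _} eq =
      ⊥-elim (≢-by-dim refl (3≤dim-ends₂ (a , t₃ + (t₂ + t₁)) ms (c , t₁) (b , t₂ + t₁)) (sym eq))

    sound : ∀ {c} → Decreasing (pair⊎ends₂Shape c) → IsPartition (encodeR c) × cond1R (encodeR c)
    sound {inj₁ ((x , t₁) , (y , t₂))} (y<x , 0<t₁ , 0<y , 0<t₂) =
      (s≤s z≤n , y<x , <-≤-trans 0<t₁ (m≤m+n t₁ _) , 0<y , <-≤-trans 0<t₂ (m≤m+n t₂ t₁)) ,
      inj₂ (refl , m<n+m (t₂ + t₁) 0<t₁ ,
                   balance-< {t₁ + (t₂ + t₁)} {2 * (t₂ + t₁)} {0} {t₂} 0<t₂ (solve (t₁ ∷ t₂ ∷ [])))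
    sound {inj₂ ((a , t₃) , ms , (c , t₁) , (b , t₂))} dec
      with decreasing-∷ʳ⁻ (a , t₃) (ms ∷ʳ (c , t₁)) dec
    ... | dec-init , _ , _ , 0<t₂ with decreasing-∷⁻ (ms ∷ʳ (c , t₁)) dec-init
    ... | _ , 0<t₃ , _ =
      (s≤s z≤n ,
       decreasing-sameParts (sameParts-ends₂ ms (λ _ → <-≤-trans 0<t₃ (m≤m+n t₃ _)) id
                                                (λ _ → <-≤-trans 0<t₂ (m≤m+n t₂ t₁))) dec) ,
      inj₁ (3≤dim-ends₂ (a , t₃ + (t₂ + t₁)) ms (c , t₁) (b , t₂ + t₁) ,
            subst (λ kₘ → mulPenult R < kₘ × kₘ < t₃ + (t₂ + t₁))
                  (sym (mulLast-∷ʳ ((a , t₃ + (t₂ + t₁)) ∷ ms ∷ʳ (c , t₁))))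
                  (subst (_< t₂ + t₁) (sym (mulPenult-∷ʳ ((a , t₃ + (t₂ + t₁)) ∷ ms))) (m<n+m t₁ 0<t₂) ,
                   m<n+m (t₂ + t₁) 0<t₃))
      where
      R : Part
      R = (a , t₃ + (t₂ + t₁)) ∷ ms ∷ʳ (c , t₁) ∷ʳ (b , t₂ + t₁)

    complete : ∀ {p} → IsPartition p → cond1R p → ∃[ c ] Decreasing (pair⊎ends₂Shape c) × encodeR c ≡ p
    complete {p} (_ , dec) (inj₂ (dim≡2 , k₂<k₁ , k₁<2k₂)) with pairShape-surjective p dim≡2
    ... | ((x , k₁) , (y , k₂)) , refl with dec
    ... | y<x , _ , 0<y , _ with m≤n⇒∃[o]o+m≡n (<⇒≤ k₂<k₁)
    ... | t₁ , refl
      with m≤n⇒∃[o]o+m≡n (<⇒≤ (balance-< {t₁} {k₂} {t₁ + k₂} {2 * k₂} k₁<2k₂ (solve (t₁ ∷ k₂ ∷ []))))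
    ... | t₂ , refl =
      inj₁ ((x , t₁) , (y , t₂)) ,
      (y<x , +-cancelʳ-< (t₂ + t₁) 0 t₁ k₂<k₁ , 0<y ,
       balance-< {0} {t₂} {t₁ + (t₂ + t₁)} {2 * (t₂ + t₁)} k₁<2k₂ (solve (t₁ ∷ t₂ ∷ []))) ,
      refl
    complete {p} (_ , dec) (inj₁ (3≤m , kₘ₋₁<kₘ , kₘ<k₁)) with ends₂Shape-surjective p 3≤m
    ... | ((a , k₁) , ms , (c , t₁) , (b , kₘ)) , refl
      rewrite mulPenult-∷ʳ ((a , k₁) ∷ ms) {c} {t₁} {b , kₘ}
            | mulLast-∷ʳ ((a , k₁) ∷ ms ∷ʳ (c , t₁)) {b} {kₘ}
      with m≤n⇒∃[o]o+m≡n (<⇒≤ kₘ₋₁<kₘ)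
    ... | t₂ , refl with m≤n⇒∃[o]o+m≡n (<⇒≤ kₘ<k₁)
    ... | t₃ , refl =
      inj₂ ((a , t₃) , ms , (c , t₁) , (b , t₂)) ,
      decreasing-sameParts (sameParts-ends₂ ms (λ _ → +-cancelʳ-< (t₂ + t₁) 0 t₃ kₘ<k₁) id
                                               (λ _ → +-cancelʳ-< t₁ 0 t₂ kₘ₋₁<kₘ)) dec ,
      refl

  size≡ : ∀ c → size (encodeL c) ≡ size (encodeR c)
  size≡ (inj₁ ((x , t₁) , (y , t₂))) = begin
    t₁ * (x + (y + x)) + (t₂ * (y + x) + 0)        ≡⟨ solve (x ∷ y ∷ t₁ ∷ t₂ ∷ []) ⟩
    (t₁ + (t₂ + t₁)) * x + ((t₂ + t₁) * y + 0)     ∎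
    where open ≡-Reasoning
  size≡ (inj₂ ((a , t₃) , ms , (c , t₁) , (b , t₂))) = begin
    size ((c + (b + a) , t₁) ∷ (b + a , t₂) ∷ (a , t₃) ∷ ms)
      ≡⟨ size-++ ((c + (b + a) , t₁) ∷ (b + a , t₂) ∷ (a , t₃) ∷ []) ms ⟩
    t₁ * (c + (b + a)) + (t₂ * (b + a) + (t₃ * a + 0)) + size ms
      ≡⟨ cong (_+ size ms) (solve (a ∷ b ∷ c ∷ t₁ ∷ t₂ ∷ t₃ ∷ [])) ⟩
    (t₃ + (t₂ + t₁)) * a + (t₁ * c + ((t₂ + t₁) * b + 0)) + size ms
      ≡⟨ sym (size-ends₂ (a , t₃ + (t₂ + t₁)) ms (c , t₁) (b , t₂ + t₁)) ⟩
    size ((a , t₃ + (t₂ + t₁)) ∷ ms ∷ʳ (c , t₁) ∷ʳ (b , t₂ + t₁)) ∎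
    where open ≡-Reasoning

  cond1L↔cond1R : ∀ n → PartitionsWith n cond1L ↔ PartitionsWith n cond1R
  cond1L↔cond1R = partitionsWith-↔
    (λ _ → by-dimension-irrelevant <×<-irrelevant <×<-irrelevant)
    (λ _ → by-dimension-irrelevant <×<-irrelevant <×<-irrelevant)
    parametrisationL parametrisationR size≡

module Bijection3 where

  encodeL encodeR : Pair ⊎ Ends₂ → Part
  encodeL (inj₁ ((a , u) , (e , s))) = (e + 2 * a , s) ∷ (a , u) ∷ []
  encodeL (inj₂ ((a , u) , ms , (c , v) , (e , s))) = (e + (a + c) , s) ∷ (a , u) ∷ ms ∷ʳ (c , v)
  encodeR (inj₁ ((a , u) , (e , s))) = (a , u + 2 * s) ∷ (e , s) ∷ []
  encodeR (inj₂ ((a , u) , ms , (c , v) , (e , s))) = (a , u + s) ∷ ms ∷ʳ (c , v + s) ∷ʳ (e , s)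

  parametrisationL : Parametrisation pair⊎ends₂Shape encodeL cond3L
  parametrisationL = record { injective = injective ; sound = sound ; complete = complete }
    where
    injective : ∀ {c c′} → encodeL c ≡ encodeL c′ → c ≡ c′
    injective {inj₁ ((a , _) , (e , _))} {inj₁ (_ , (e′ , _))} eq with ∷²-injective eq
    ... | first≡ , refl , _ with ,-injective first≡
    ... | λ₁≡ , refl with +-cancelʳ-≡ (2 * a) e e′ λ₁≡
    ... | refl = refl
    injective {inj₂ ((a , _) , ms , (c , _) , (e , _))} {inj₂ (_ , ms′ , _ , (e′ , _))} eq
      with ∷-injective eq
    ... | first≡ , rest≡ with ends-injective ms ms′ rest≡
    ... | refl , refl , refl with ,-injective first≡
    ... | λ₁≡ , refl with +-cancelʳ-≡ (a + c) e e′ λ₁≡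
    ... | refl = refl
    injective {inj₁ _} {inj₂ ((a , u) , ms , (c , v) , (e , s))} eq =
      ⊥-elim (≢-by-dim refl (s≤s (2≤dim-ends (a , u) ms (c , v))) eq)
    injective {inj₂ ((a , u) , ms , (c , v) , (e , s))} {inj₁ _} eq =
      ⊥-elim (≢-by-dim refl (s≤s (2≤dim-ends (a , u) ms (c , v))) (sym eq))

    sound : ∀ {c} → Decreasing (pair⊎ends₂Shape c) → IsPartition (encodeL c) × cond3L (encodeL c)
    sound {inj₁ ((a , u) , (e , s))} (e<a , 0<u , 0<e , 0<s) =
      (s≤s z≤n , <-≤-trans (m<n+m a 0<e) (+-monoʳ-≤ e (m≤m+n a (a + 0))) , 0<s , <-trans 0<e e<a , 0<u) ,
      inj₂ (refl , m<n+m (2 * a) 0<e , balance-< {e + 2 * a} {3 * a} {e} {a} e<a (solve (a ∷ e ∷ [])))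
    sound {inj₂ ((a , u) , ms , (c , v) , (e , s))} dec with decreasing-∷ʳ⁻ (a , u) (ms ∷ʳ (c , v)) dec
    ... | dec-init , e<λₘ , 0<e , 0<s =
      (s≤s z≤n , ≤-<-trans (m≤m+n a c) (m<n+m (a + c) 0<e) , 0<s , dec-init) ,
      inj₁ (s≤s (2≤dim-ends (a , u) ms (c , v)) ,
            subst (λ λₘ → a + λₘ < e + (a + c) × e + (a + c) < a + 2 * λₘ) (sym λₘ≡c)
                  (m<n+m (a + c) 0<e ,
                   balance-< {e + (a + c)} {a + 2 * c} {e} {c} (subst (e <_) λₘ≡c e<λₘ)
                             (solve (a ∷ c ∷ e ∷ []))))
      where
      λₘ≡c : lamLast ((a , u) ∷ ms ∷ʳ (c , v)) ≡ c
      λₘ≡c = lamLast-∷ʳ ((a , u) ∷ ms)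

    complete : ∀ {p} → IsPartition p → cond3L p → ∃[ c ] Decreasing (pair⊎ends₂Shape c) × encodeL c ≡ p
    complete {p} (_ , dec) (inj₂ (dim≡2 , 2λ₂<λ₁ , λ₁<3λ₂)) with pairShape-surjective p dim≡2
    ... | ((d , s) , (a , u)) , refl with dec
    ... | _ , 0<s , 0<a , 0<u with m≤n⇒∃[o]o+m≡n (<⇒≤ 2λ₂<λ₁)
    ... | e , refl =
      inj₁ ((a , u) , (e , s)) ,
      (balance-< {e} {a} {e + 2 * a} {3 * a} λ₁<3λ₂ (solve (a ∷ e ∷ [])) , 0<u ,
       +-cancelʳ-< (2 * a) 0 e 2λ₂<λ₁ , 0<s) ,
      refl
    complete {p} (_ , dec) (inj₁ (3≤m , λ₂+λₘ<λ₁ , λ₁<λ₂+2λₘ))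
      with endsShape-surjective p (≤-trans (n≤1+n 2) 3≤m)
    ... | (_ , [] , _) , refl = ⊥-elim (<-irrefl refl 3≤m)
    ... | ((d , s) , (a , u) ∷ ms , (c , v)) , refl rewrite lamLast-∷ʳ ((d , s) ∷ (a , u) ∷ ms) {c} {v}
      with dec
    ... | _ , 0<s , dec-tail with m≤n⇒∃[o]o+m≡n (<⇒≤ λ₂+λₘ<λ₁)
    ... | e , refl =
      inj₂ ((a , u) , ms , (c , v) , (e , s)) ,
      decreasing-∷ʳ⁺ (a , u) (ms ∷ʳ (c , v)) dec-tail
        (subst (e <_) (sym (lamLast-∷ʳ ((a , u) ∷ ms)))
               (balance-< {e} {c} {e + (a + c)} {a + 2 * c} λ₁<λ₂+2λₘ (solve (a ∷ c ∷ e ∷ []))))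
        (+-cancelʳ-< (a + c) 0 e λ₂+λₘ<λ₁) 0<s ,
      refl

  parametrisationR : Parametrisation pair⊎ends₂Shape encodeR cond3R
  parametrisationR = record { injective = injective ; sound = sound ; complete = complete }
    where
    injective : ∀ {c c′} → encodeR c ≡ encodeR c′ → c ≡ c′
    injective {inj₁ ((_ , u) , (_ , s))} {inj₁ ((_ , u′) , _)} eq with ∷²-injective eq
    ... | first≡ , refl , _ with ,-injective first≡
    ... | refl , k₁≡ with +-cancelʳ-≡ (2 * s) u u′ k₁≡
    ... | refl = refl
    injective {inj₂ ((_ , u) , ms , (_ , v) , (_ , s))} {inj₂ ((_ , u′) , ms′ , (_ , v′) , _)} eq
      with ends₂-injective ms ms′ eq
    ... | first≡ , refl , penult≡ , refl with ,-injective first≡ | ,-injective penult≡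
    ... | refl , k₁≡ | refl , kₘ₋₁≡ with +-cancelʳ-≡ s u u′ k₁≡ | +-cancelʳ-≡ s v v′ kₘ₋₁≡
    ... | refl | refl = refl
    injective {inj₁ _} {inj₂ ((a , u) , ms , (c , v) , (e , s))} eq =
      ⊥-elim (≢-by-dim refl (3≤dim-ends₂ (a , u + s) ms (c , v + s) (e , s)) eq)
    injective {inj₂ ((a , u) , ms , (c , v) , (e , s))} {inj₁ _} eq =
      ⊥-elim (≢-by-dim refl (3≤dim-ends₂ (a , u + s) ms (c , v + s) (e , s)) (sym eq))

    sound : ∀ {c} → Decreasing (pair⊎ends₂Shape c) → IsPartition (encodeR c) × cond3R (encodeR c)
    sound {inj₁ ((a , u) , (e , s))} (e<a , 0<u , 0<e , 0<s) =
      (s≤s z≤n , e<a , <-≤-trans 0<u (m≤m+n u _) , 0<e , 0<s) , inj₂ (refl , m<n+m (2 * s) 0<u)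
    sound {inj₂ ((a , u) , ms , (c , v) , (e , s))} dec with decreasing-∷ʳ⁻ (a , u) (ms ∷ʳ (c , v)) dec
    ... | dec-init , _ with decreasing-∷ʳ⁻ (a , u) ms dec-init | decreasing-∷⁻ (ms ∷ʳ (c , v)) dec-init
    ... | _ , _ , _ , 0<v | _ , 0<u , _ =
      (s≤s z≤n , decreasing-sameParts (sameParts-ends₂ ms (λ _ → <-≤-trans 0<u (m≤m+n u s))
                                                          (λ _ → <-≤-trans 0<v (m≤m+n v s)) id) dec) ,
      inj₁ (3≤dim-ends₂ (a , u + s) ms (c , v + s) (e , s) ,
            subst (λ kₘ → kₘ < mulPenult R × kₘ < u + s)
                  (sym (mulLast-∷ʳ ((a , u + s) ∷ ms ∷ʳ (c , v + s))))
                  (subst (s <_) (sym (mulPenult-∷ʳ ((a , u + s) ∷ ms))) (m<n+m s 0<v) , m<n+m s 0<u))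
      where
      R : Part
      R = (a , u + s) ∷ ms ∷ʳ (c , v + s) ∷ʳ (e , s)

    complete : ∀ {p} → IsPartition p → cond3R p → ∃[ c ] Decreasing (pair⊎ends₂Shape c) × encodeR c ≡ p
    complete {p} (_ , dec) (inj₂ (dim≡2 , 2kₘ<k₁)) with pairShape-surjective p dim≡2
    ... | ((a , k₁) , (e , s)) , refl with dec | m≤n⇒∃[o]o+m≡n (<⇒≤ 2kₘ<k₁)
    ... | e<a , _ , 0<e , 0<s | u , refl =
      inj₁ ((a , u) , (e , s)) , (e<a , +-cancelʳ-< (2 * s) 0 u 2kₘ<k₁ , 0<e , 0<s) , refl
    complete {p} (_ , dec) (inj₁ (3≤m , kₘ<kₘ₋₁ , kₘ<k₁)) with ends₂Shape-surjective p 3≤m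
    ... | ((a , k₁) , ms , (c , kₘ₋₁) , (e , s)) , refl
      rewrite mulPenult-∷ʳ ((a , k₁) ∷ ms) {c} {kₘ₋₁} {e , s}
            | mulLast-∷ʳ ((a , k₁) ∷ ms ∷ʳ (c , kₘ₋₁)) {e} {s}
      with m≤n⇒∃[o]o+m≡n (<⇒≤ kₘ<kₘ₋₁) | m≤n⇒∃[o]o+m≡n (<⇒≤ kₘ<k₁)
    ... | v , refl | u , refl =
      inj₂ ((a , u) , ms , (c , v) , (e , s)) ,
      decreasing-sameParts (sameParts-ends₂ ms (λ _ → +-cancelʳ-< s 0 u kₘ<k₁)
                                               (λ _ → +-cancelʳ-< s 0 v kₘ<kₘ₋₁) id) dec ,
      refl

  size≡ : ∀ c → size (encodeL c) ≡ size (encodeR c)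
  size≡ (inj₁ ((a , u) , (e , s))) = begin
    s * (e + 2 * a) + (u * a + 0)      ≡⟨ solve (a ∷ e ∷ s ∷ u ∷ []) ⟩
    (u + 2 * s) * a + (s * e + 0)      ∎
    where open ≡-Reasoning
  size≡ (inj₂ ((a , u) , ms , (c , v) , (e , s))) = begin
    size ((e + (a + c) , s) ∷ (a , u) ∷ ms ∷ʳ (c , v))
      ≡⟨ size-middle ((e + (a + c) , s) ∷ (a , u) ∷ []) ms ((c , v) ∷ []) ⟩
    s * (e + (a + c)) + (u * a + (v * c + 0)) + size ms
      ≡⟨ cong (_+ size ms) (solve (a ∷ c ∷ e ∷ s ∷ u ∷ v ∷ [])) ⟩
    (u + s) * a + ((v + s) * c + (s * e + 0)) + size ms
      ≡⟨ sym (size-ends₂ (a , u + s) ms (c , v + s) (e , s)) ⟩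
    size ((a , u + s) ∷ ms ∷ʳ (c , v + s) ∷ʳ (e , s)) ∎
    where open ≡-Reasoning

  cond3L↔cond3R : ∀ n → PartitionsWith n cond3L ↔ PartitionsWith n cond3R
  cond3L↔cond3R = partitionsWith-↔
    (λ _ → by-dimension-irrelevant <×<-irrelevant <×<-irrelevant)
    (λ _ → by-dimension-irrelevant <×<-irrelevant ≤-irrelevant)
    parametrisationL parametrisationR size≡

mainTheorem9 : (n : ℕ) → 1 ≤ n →
    (PartitionsWith n cond1L ↔ PartitionsWith n cond1R)
    × (PartitionsWith n cond2L ↔ PartitionsWith n cond2R)
    × (PartitionsWith n cond3L ↔ PartitionsWith n cond3R)
    × (PartitionsWith n cond4L ↔ PartitionsWith n cond4R)
mainTheorem9 n _ =
  Bijection1.cond1L↔cond1R n , Bijection2.cond2L↔cond2R n ,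
  Bijection3.cond3L↔cond3R n , Bijection4.cond4L↔cond4R n
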